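{- The diameter of the swap graph $\mathcal{G}_m$ is $\Omega\!\left(\frac{m}{\ln m}\right)$.
   Context: Sequences consist of pairwise distinct integers; $\tau(x,i)$ exchanges $x[i]$ and $x[i+1]$. The Cartesian tree $C(x)$ of $x[1\ldots m]$ has as root the position $g$ of the minimum of $x$, left subtree $C(x[1\ldots g-1])$ and right subtree the Cartesian tree of $x[g+1\ldots m]$. $\mathcal{C}_m$ is the set of Cartesian trees (binary trees) with $m$ nodes. For $T\in\mathcal{C}_m$, $\mathrm{ng}(T)=\bigcup_{i=1}^{m-1}\{C(y): \exists x,\ C(x)=T,\ y=\tau(x,i)\}$. The swap graph $\mathcal{G}_m$ has vertex set $\mathcal{C}_m$ and an edge $\{C(x),C(y)\}$ whenever $C(y)\in\mathrm{ng}(C(x))$. -}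

module Defs where

open import Data.Nat using (ℕ; zero; suc; _+_; _*_; _≤_)
open import Data.Nat.Logarithm using (⌊log₂_⌋)
open import Data.Integer using (ℤ; _⊓_)
open import Data.Integer.Properties using (_≟_)
open import Data.List using (List; []; _∷_; _++_; length; foldr)
open import Data.List.Relation.Unary.Unique.Propositional using (Unique)
open import Data.Product using (Σ; ∃; _×_; _,_; proj₁; proj₂; map₁)
open import Relation.Nullary using (yes; no)
open import Relation.Binary.PropositionalEquality using (_≡_)

data Tree : Set where
  leaf : Tree
  node : Tree → Tree → Tree

size : Tree → ℕ
size leaf       = 0
size (node l r) = suc (size l + size r)

splitOn : ℤ → List ℤ → List ℤ × List ℤ
splitOn m [] = [] , []
splitOn m (y ∷ ys) with y ≟ m
... | yes _ = [] , ys
... | no  _ = map₁ (y ∷_) (splitOn m ys)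

-- Cartesian tree with fuel (fuel = length suffices).
cart : ℕ → List ℤ → Tree
cart zero    _        = leaf
cart (suc f) []       = leaf
cart (suc f) (a ∷ xs) =
  let mn = foldr _⊓_ a xs
      p  = splitOn mn (a ∷ xs)
  in node (cart f (proj₁ p)) (cart f (proj₂ p))

C : List ℤ → Tree
C x = cart (length x) x

Swapped : List ℤ → List ℤ → Set
Swapped x y = Σ (List ℤ) λ l → Σ ℤ λ a → Σ ℤ λ b → Σ (List ℤ) λ r →
  (x ≡ l ++ a ∷ b ∷ r) × (y ≡ l ++ b ∷ a ∷ r)

Edge : ℕ → Tree → Tree → Set
Edge m T T' = Σ (List ℤ) λ x → Σ (List ℤ) λ y →
  Unique x × length x ≡ m × Swapped x y × C x ≡ T × C y ≡ T'

data Walk (m : ℕ) : Tree → Tree → ℕ → Set where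
  here : ∀ {T} → Walk m T T 0
  step : ∀ {T U V k} → Edge m T U → Walk m U V k → Walk m T V (suc k)

-- Read a sequence x from left to right while keeping the stack of its left-to-right
-- minima, and record the stack height after each step. This list depends only on the
-- Cartesian tree C x and determines it: it lists the nodes in in-order, each with its
-- number of ancestors-or-self not to its right. Swapping x[i] and x[i+1] keeps the
-- heights before position i, replaces the i-th one, and shifts a block of heights right
-- after it by ±1, so a tree has at most 2m(m+1)² neighbours in G_m and a ball of radius
-- K has at most (1 + 2m(m+1)²)^K ≤ 2^(8K⌊log₂ m⌋) elements. The 2^(m-1) path-shaped
-- trees with m nodes therefore cannot all lie within distance K = ⌊(m-2)/(8⌊log₂ m⌋)⌋
-- of a fixed tree; one of them is at distance d > K, whence m ≤ 9⌊log₂ m⌋ d.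

module Submission where

open import Defs
open import Data.Nat as ℕ
  using (ℕ; zero; suc; pred; _+_; _*_; _^_; _≤_; _<_; z≤n; s≤s; NonZero)
import Data.Nat.Properties as ℕ
open import Data.Nat.DivMod using (_/_; _%_; m≡m%n+[m/n]*n; m%n<n; m/n*n≤m)
open import Data.Nat.Logarithm using (⌊log₂_⌋; ⌊log₂⌋-mono-≤; ⌊log₂[2^n]⌋≡n)
open import Data.Integer as ℤ using (ℤ; _⊓_)
import Data.Integer.Properties as ℤₚ
open import Data.List
  using (List; []; _∷_; _++_; length; foldr; map; concatMap; cartesianProduct; downFrom)
import Data.List.Properties as List
open import Data.List.Relation.Unary.All as All using (All; []; _∷_)
import Data.List.Relation.Unary.All.Properties as All
open import Data.List.Relation.Unary.Any using (here; there; any?; index; _─_)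
open import Data.List.Relation.Unary.Unique.Propositional using (Unique)
open import Data.List.Relation.Unary.AllPairs using ([]; _∷_)
import Data.List.Relation.Unary.Unique.Propositional.Properties as Unique
open import Data.List.Relation.Binary.Disjoint.Propositional using (Disjoint)
open import Data.List.Membership.Propositional using (_∈_; _∉_; lose)
open import Data.List.Membership.Propositional.Properties
  using (∈-++⁺ʳ; ∈-map⁺; ∈-map⁻; ∈-concatMap⁺; ∈-cartesianProduct⁺; ∈-downFrom⁺)
open import Data.Product using (Σ; ∃; ∃₂; _×_; _,_; proj₁; proj₂; map₁)
open import Data.Sum using (_⊎_; inj₁; inj₂)
open import Data.Unit using (⊤)
open import Data.Empty using (⊥-elim)
open import Relation.Nullary using (yes; no)
open import Relation.Binary using (DecidableEquality; tri<; tri≈; tri>)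
open import Function using (_∘_)
open import Relation.Binary.PropositionalEquality

length-++-∷-≤ : ∀ {A : Set} {n} (xs : List A) {v} ys →
  length (xs ++ v ∷ ys) ≤ suc n → length xs ≤ n × length ys ≤ n
length-++-∷-≤ xs {v} ys ≤1+n =
  ℕ.≤-trans (List.length-++-≤ˡ xs) ≤n , ℕ.≤-trans (List.length-++-≤ʳ ys {xs}) ≤n
  where
  ≤n = ℕ.≤-pred (subst (_≤ _) (List.length-++-sucʳ xs v ys) ≤1+n)

++-∷-injective : ∀ {A : Set} {v : A} xs ys xs′ ys′ → v ∉ ys → v ∉ ys′ →
  xs ++ v ∷ ys ≡ xs′ ++ v ∷ ys′ → xs ≡ xs′ × ys ≡ ys′
++-∷-injective []       ys []         ys′ _ _ refl = refl , refl
++-∷-injective []       ys (x′ ∷ xs′) ys′ v∉ys _ eq with List.∷-injective eq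
... | refl , ys≡ = ⊥-elim (v∉ys (subst (_ ∈_) (sym ys≡) (∈-++⁺ʳ xs′ (here refl))))
++-∷-injective (x ∷ xs) ys []         ys′ _ v∉ys′ eq with List.∷-injective eq
... | refl , ≡ys′ = ⊥-elim (v∉ys′ (subst (_ ∈_) ≡ys′ (∈-++⁺ʳ xs (here refl))))
++-∷-injective (x ∷ xs) ys (x′ ∷ xs′) ys′ v∉ys v∉ys′ eq with List.∷-injective eq
... | refl , eq′ = map₁ (cong (x ∷_)) (++-∷-injective xs ys xs′ ys′ v∉ys v∉ys′ eq′)

mapPrefix : ∀ {A : Set} → (A → A) → ℕ → List A → List A
mapPrefix f zero    xs       = xs
mapPrefix f (suc j) []       = []
mapPrefix f (suc j) (x ∷ xs) = f x ∷ mapPrefix f j xs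

mapPrefix-inverse : ∀ {A : Set} {f g : A → A} → (∀ x → g (f x) ≡ x) →
  ∀ j xs → mapPrefix g j (mapPrefix f j xs) ≡ xs
mapPrefix-inverse g∘f≗id zero    xs       = refl
mapPrefix-inverse g∘f≗id (suc j) []       = refl
mapPrefix-inverse g∘f≗id (suc j) (x ∷ xs) = cong₂ _∷_ (g∘f≗id x) (mapPrefix-inverse g∘f≗id j xs)

length-concatMap-≤ : ∀ {A B : Set} (f : A → List B) {n} → (∀ x → length (f x) ≤ n) →
  ∀ xs → length (concatMap f xs) ≤ length xs * n
length-concatMap-≤ f |f|≤n []       = z≤n
length-concatMap-≤ f |f|≤n (x ∷ xs) = ℕ.≤-trans (ℕ.≤-reflexive (List.length-++ (f x)))
  (ℕ.+-mono-≤ (|f|≤n x) (length-concatMap-≤ f |f|≤n xs))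

length-cartesianProduct : ∀ {A B : Set} (xs : List A) (ys : List B) →
  length (cartesianProduct xs ys) ≡ length xs * length ys
length-cartesianProduct []       ys = refl
length-cartesianProduct (x ∷ xs) ys = trans (List.length-++ (map (x ,_) ys))
  (cong₂ _+_ (List.length-map (x ,_) ys) (length-cartesianProduct xs ys))

∈-─ : ∀ {A : Set} {x y : A} {xs} (x∈ : x ∈ xs) → y ∈ xs → y ≢ x → y ∈ (xs ─ x∈)
∈-─ (here refl) (here refl) y≢x = ⊥-elim (y≢x refl)
∈-─ (here refl) (there y∈) _    = y∈
∈-─ (there x∈)  (here refl) _   = here refl
∈-─ (there x∈)  (there y∈) y≢x = there (∈-─ x∈ y∈ y≢x)

pigeonhole : ∀ {A : Set} → DecidableEquality A → ∀ {xs} (ys : List A) →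
  Unique xs → length ys < length xs → ∃ λ x → x ∈ xs × x ∉ ys
pigeonhole _≟_ {x ∷ xs} ys (x≢xs ∷ xs-unique) |ys|< with any? (x ≟_) ys
... | no  x∉ys = x , here refl , x∉ys
... | yes x∈ys with pigeonhole _≟_ (ys ─ x∈ys) xs-unique
  (subst (_≤ length xs) (List.length-removeAt′ ys (index x∈ys)) (ℕ.≤-pred |ys|<))
...   | y , y∈xs , y∉ys─x =
  y , there y∈xs , λ y∈ys → y∉ys─x (∈-─ x∈ys y∈ys (All.lookup x≢xs y∈xs ∘ sym))

-- Stacks of left-to-right minima

-- Entries equal to v stay, as splitOn cuts at the first occurrence of the minimum.
pop : ℤ → List ℤ → List ℤ
pop v [] = []
pop v (s ∷ S) with s ℤ.≤? v
... | yes _ = s ∷ S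
... | no  _ = pop v S

push : ℤ → List ℤ → List ℤ
push v S = v ∷ pop v S

stackAfter : List ℤ → List ℤ → List ℤ
stackAfter S []      = S
stackAfter S (v ∷ x) = stackAfter (push v S) x

heights : List ℤ → List ℤ → List ℕ
heights S []      = []
heights S (v ∷ x) = length (push v S) ∷ heights (push v S) x

_⊴_ : List ℤ → ℤ → Set
[]      ⊴ v = ⊤
(s ∷ _) ⊴ v = s ℤ.≤ v

⊴-trans : ∀ {S a b} → S ⊴ a → a ℤ.≤ b → S ⊴ b
⊴-trans {[]}    _   _   = _
⊴-trans {_ ∷ _} s≤a a≤b = ℤₚ.≤-trans s≤a a≤b

pop-⊴ : ∀ {v} S → S ⊴ v → pop v S ≡ S
pop-⊴ {v} []      _   = refl
pop-⊴ {v} (s ∷ S) s≤v with s ℤ.≤? v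
... | yes _   = refl
... | no  s≰v = ⊥-elim (s≰v s≤v)

pop-> : ∀ {v s} S → v ℤ.< s → pop v (s ∷ S) ≡ pop v S
pop-> {v} {s} S v<s with s ℤ.≤? v
... | yes s≤v = ⊥-elim (ℤₚ.<⇒≱ v<s s≤v)
... | no  _   = refl

pop-pop : ∀ {a b} S → a ℤ.≤ b → pop a (pop b S) ≡ pop a S
pop-pop {a} {b} []      _   = refl
pop-pop {a} {b} (s ∷ S) a≤b with s ℤ.≤? b
... | yes _   = refl
... | no  s≰b = trans (pop-pop S a≤b) (sym (pop-> S (ℤₚ.≤-<-trans a≤b (ℤₚ.≰⇒> s≰b))))

pop-++ : ∀ {v} T S → S ⊴ v → pop v (T ++ S) ≡ pop v T ++ S
pop-++ {v} []      S S⊴v = pop-⊴ S S⊴v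
pop-++ {v} (t ∷ T) S S⊴v with t ℤ.≤? v
... | yes _ = refl
... | no  _ = pop-++ T S S⊴v

pop-All : ∀ {P : ℤ → Set} {v} S → All P S → All P (pop v S)
pop-All {v = v} []      []         = []
pop-All {v = v} (s ∷ S) (ps ∷ pS) with s ℤ.≤? v
... | yes _ = ps ∷ pS
... | no  _ = pop-All S pS

pop-above : ∀ {v} S → All (v ℤ.<_) S → pop v S ≡ []
pop-above []      []           = refl
pop-above (s ∷ S) (v<s ∷ v<S) = trans (pop-> S v<s) (pop-above S v<S)

length-pop : ∀ v S → length (pop v S) ≤ length S
length-pop v []      = z≤n
length-pop v (s ∷ S) with s ℤ.≤? v
... | yes _ = ℕ.≤-refl
... | no  _ = ℕ.m≤n⇒m≤1+n (length-pop v S)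

length-stackAfter : ∀ S x → length (stackAfter S x) ≤ length S + length x
length-stackAfter S []      = ℕ.m≤m+n (length S) 0
length-stackAfter S (v ∷ x) = begin
  length (stackAfter (push v S) x) ≤⟨ length-stackAfter (push v S) x ⟩
  suc (length (pop v S)) + length x ≤⟨ ℕ.+-monoˡ-≤ (length x) (s≤s (length-pop v S)) ⟩
  suc (length S) + length x         ≡⟨ ℕ.+-suc (length S) (length x) ⟨
  length S + suc (length x)         ∎
  where open ℕ.≤-Reasoning

pop-stackAfter : ∀ {v} s S A → S ⊴ v → All (S ⊴_) A → All (v ℤ.<_) s → All (v ℤ.<_) A →
  pop v (stackAfter (s ++ S) A) ≡ S
pop-stackAfter s S [] S⊴v _ v<s _ =
  trans (pop-++ s S S⊴v) (cong (_++ S) (pop-above s v<s))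
pop-stackAfter s S (a ∷ A) S⊴v (S⊴a ∷ S⊴A) v<s (v<a ∷ v<A)
  rewrite pop-++ s S S⊴a = pop-stackAfter (a ∷ pop a s) S A S⊴v S⊴A (v<a ∷ pop-All s v<s) v<A

pop-extra : ∀ {v b} T S → S ⊴ b →
  pop v (T ++ b ∷ S) ≡ pop v (T ++ S) ⊎
  ∃ λ T′ → pop v (T ++ b ∷ S) ≡ T′ ++ b ∷ S × pop v (T ++ S) ≡ T′ ++ S
pop-extra {v} {b} []      S S⊴b with b ℤ.≤? v
... | yes b≤v = inj₂ ([] , refl , pop-⊴ S (⊴-trans S⊴b b≤v))
... | no  _   = inj₁ refl
pop-extra {v}     (t ∷ T) S S⊴b with t ℤ.≤? v
... | yes _ = inj₂ (t ∷ T , refl , refl)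
... | no  _ = pop-extra T S S⊴b

heights-++ : ∀ S x y → heights S (x ++ y) ≡ heights S x ++ heights (stackAfter S x) y
heights-++ S []      y = refl
heights-++ S (v ∷ x) y = cong (_ ∷_) (heights-++ (push v S) x y)

length-heights : ∀ S x → length (heights S x) ≡ length x
length-heights S []      = refl
length-heights S (v ∷ x) = cong suc (length-heights (push v S) x)

heights-extra : ∀ {b} r T S → S ⊴ b →
  ∃ λ j → j ≤ length r × heights (T ++ b ∷ S) r ≡ mapPrefix suc j (heights (T ++ S) r)
heights-extra []      T S _ = 0 , z≤n , refl
heights-extra {b} (v ∷ r) T S S⊴b with pop-extra {v} T S S⊴b
... | inj₁ eq rewrite eq = 0 , z≤n , refl
... | inj₂ (T′ , eq₁ , eq₂) rewrite eq₁ | eq₂ with heights-extra r (v ∷ T′) S S⊴b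
...   | j , j≤ , eq = suc j , s≤s j≤ , cong₂ _∷_ (List.length-++-sucʳ (v ∷ T′) b S) eq

-- Stack heights encode Cartesian trees

rightDepths : ℕ → Tree → List ℕ
rightDepths k leaf       = []
rightDepths k (node l r) = rightDepths k l ++ suc k ∷ rightDepths (suc k) r

code : Tree → List ℕ
code = rightDepths 0

rightDepths-> : ∀ k t → All (k ℕ.<_) (rightDepths k t)
rightDepths-> k leaf       = []
rightDepths-> k (node l r) =
  All.++⁺ (rightDepths-> k l) (ℕ.≤-refl ∷ All.map ℕ.<⇒≤ (rightDepths-> (suc k) r))

∉-rightDepths : ∀ k t → k ∉ rightDepths k t
∉-rightDepths k t k∈ = ℕ.<-irrefl refl (All.lookup (rightDepths-> k t) k∈)

rightDepths-node≢[] : ∀ k l r → rightDepths k (node l r) ≢ []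
rightDepths-node≢[] k l r = (λ ()) ∘ List.++-conicalʳ (rightDepths k l) _

rightDepths-injective : ∀ k {t u} → rightDepths k t ≡ rightDepths k u → t ≡ u
rightDepths-injective k {leaf}     {leaf}       _  = refl
rightDepths-injective k {leaf}     {node l r}   eq = ⊥-elim (rightDepths-node≢[] k l r (sym eq))
rightDepths-injective k {node l r} {leaf}       eq = ⊥-elim (rightDepths-node≢[] k l r eq)
rightDepths-injective k {node l r} {node l′ r′} eq
  with ++-∷-injective _ _ _ _ (∉-rightDepths (suc k) r) (∉-rightDepths (suc k) r′) eq
... | eqˡ , eqʳ = cong₂ node (rightDepths-injective k eqˡ) (rightDepths-injective (suc k) eqʳ)

foldr-⊓-≤ : ∀ a xs → All (foldr _⊓_ a xs ℤ.≤_) (a ∷ xs)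
foldr-⊓-≤ a []       = ℤₚ.≤-refl ∷ []
foldr-⊓-≤ a (x ∷ xs) with foldr-⊓-≤ a xs
... | m≤a ∷ m≤xs = ℤₚ.≤-trans (ℤₚ.i⊓j≤j x _) m≤a ∷ ℤₚ.i⊓j≤i x _
                 ∷ All.map (ℤₚ.≤-trans (ℤₚ.i⊓j≤j x _)) m≤xs

foldr-⊓-∈ : ∀ a xs → foldr _⊓_ a xs ∈ a ∷ xs
foldr-⊓-∈ a []       = here refl
foldr-⊓-∈ a (x ∷ xs) with ℤₚ.⊓-sel x (foldr _⊓_ a xs)
... | inj₁ eq rewrite eq = there (here refl)
... | inj₂ eq rewrite eq with foldr-⊓-∈ a xs
...   | here  m≡a  = here m≡a
...   | there m∈xs = there (there m∈xs)

splitOn-++ : ∀ {m} x → m ∈ x → x ≡ proj₁ (splitOn m x) ++ m ∷ proj₂ (splitOn m x)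
splitOn-++ {m} (y ∷ ys) m∈x with y ℤ.≟ m
splitOn-++ (y ∷ ys) _            | yes refl = refl
splitOn-++ (y ∷ ys) (here refl)  | no  y≢m  = ⊥-elim (y≢m refl)
splitOn-++ (y ∷ ys) (there m∈ys) | no  _    = cong (y ∷_) (splitOn-++ ys m∈ys)

splitOn-≢ : ∀ m x → All (_≢ m) (proj₁ (splitOn m x))
splitOn-≢ m []       = []
splitOn-≢ m (y ∷ ys) with y ℤ.≟ m
... | yes _   = []
... | no  y≢m = y≢m ∷ splitOn-≢ m ys

heights-cart : ∀ f x S → length x ≤ f → All (S ⊴_) x →
  heights S x ≡ rightDepths (length S) (cart f x)
heights-cart zero    []       S _ _ = refl
heights-cart (suc f) []       S _ _ = refl
heights-cart (suc f) (a ∷ xs) S |x|≤ S⊴x = begin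
    heights S (a ∷ xs)
  ≡⟨ cong (heights S) split ⟩
    heights S (A ++ mn ∷ B)
  ≡⟨ heights-++ S A (mn ∷ B) ⟩
    heights S A ++ length (push mn (stackAfter S A)) ∷ heights (push mn (stackAfter S A)) B
  ≡⟨ cong (λ S′ → heights S A ++ length S′ ∷ heights S′ B) pushed ⟩
    heights S A ++ suc (length S) ∷ heights (mn ∷ S) B
  ≡⟨ cong₂ (λ hA hB → hA ++ suc (length S) ∷ hB)
       (heights-cart f A S (proj₁ sizes) S⊴A) (heights-cart f B (mn ∷ S) (proj₂ sizes) mn≤B) ⟩
    rightDepths (length S) (cart f A) ++ suc (length S) ∷ rightDepths (suc (length S)) (cart f B)
  ∎
  where
  open ≡-Reasoning
  mn = foldr _⊓_ a xs
  A  = proj₁ (splitOn mn (a ∷ xs))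
  B  = proj₂ (splitOn mn (a ∷ xs))
  split : a ∷ xs ≡ A ++ mn ∷ B
  split = splitOn-++ (a ∷ xs) (foldr-⊓-∈ a xs)
  mn≤x : All (mn ℤ.≤_) (A ++ mn ∷ B)
  mn≤x = subst (All _) split (foldr-⊓-≤ a xs)
  S⊴x′ : All (S ⊴_) (A ++ mn ∷ B)
  S⊴x′ = subst (All _) split S⊴x
  S⊴A = All.++⁻ˡ A S⊴x′
  mn≤B = All.tail (All.++⁻ʳ A mn≤x)
  mn<A : All (mn ℤ.<_) A
  mn<A = All.zipWith (λ (m≤ , ≢m) → ℤₚ.≤∧≢⇒< m≤ (≢m ∘ sym))
                     (All.++⁻ˡ A mn≤x , splitOn-≢ mn (a ∷ xs))
  pushed : push mn (stackAfter S A) ≡ mn ∷ S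
  pushed = cong (mn ∷_)
    (pop-stackAfter [] S A (All.head (All.++⁻ʳ A S⊴x′)) S⊴A [] mn<A)
  sizes : length A ≤ f × length B ≤ f
  sizes = length-++-∷-≤ A B (subst (λ x → length x ≤ suc f) split |x|≤)

heights-C : ∀ x → heights [] x ≡ code (C x)
heights-C x = heights-cart (length x) x [] ℕ.≤-refl (All.universal _ x)

-- Adjacent transpositions

-- With Q = push a S, reading a b leaves the stack b ∷ Q and reading b a leaves Q.
heights-swap-< : ∀ {a b} S r → a ℤ.< b → ∃ λ j → j ≤ suc (length r) ×
  heights (push a S) (b ∷ r) ≡ mapPrefix suc j (heights (push b S) (a ∷ r))
heights-swap-< {a} {b} S r a<b with heights-extra r [] (push a S) (ℤₚ.<⇒≤ a<b)
... | j , j≤ , eq = suc j , s≤s j≤ , (begin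
    heights Q (b ∷ r)
  ≡⟨ cong (λ S′ → length S′ ∷ heights S′ r) (cong (b ∷_) (pop-⊴ Q (ℤₚ.<⇒≤ a<b))) ⟩
    suc (length Q) ∷ heights (b ∷ Q) r
  ≡⟨ cong (suc (length Q) ∷_) eq ⟩
    suc (length Q) ∷ mapPrefix suc j (heights Q r)
  ≡⟨ cong (λ S′ → mapPrefix suc (suc j) (length S′ ∷ heights S′ r)) (sym push-push) ⟩
    mapPrefix suc (suc j) (heights (push b S) (a ∷ r))
  ∎)
  where
  open ≡-Reasoning
  Q = push a S
  push-push : push a (push b S) ≡ Q
  push-push = cong (a ∷_) (trans (pop-> (pop b S) a<b) (pop-pop S (ℤₚ.<⇒≤ a<b)))

shifts : List (ℕ → ℕ)
shifts = suc ∷ pred ∷ []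

heights-swap-tail : ∀ S a b r → ∃₂ λ f j → f ∈ shifts × j ≤ suc (length r) ×
  heights (push b S) (a ∷ r) ≡ mapPrefix f j (heights (push a S) (b ∷ r))
heights-swap-tail S a b r with ℤₚ.<-cmp a b
... | tri≈ _ refl _ = suc , 0 , here refl , z≤n , refl
... | tri< a<b _ _ with heights-swap-< S r a<b
...   | j , j≤ , eq = pred , j , there (here refl) , j≤ ,
        sym (trans (cong (mapPrefix pred j) eq) (mapPrefix-inverse (λ _ → refl) j _))
heights-swap-tail S a b r | tri> _ _ b<a with heights-swap-< S r b<a
...   | j , j≤ , eq = suc , j , here refl , j≤ , eq

perturb : ℕ → ℕ → ℕ → (ℕ → ℕ) → List ℕ → List ℕ
perturb i       e j f []      = []
perturb zero    e j f (_ ∷ c) = e ∷ mapPrefix f j c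
perturb (suc i) e j f (v ∷ c) = v ∷ perturb i e j f c

perturb-++ : ∀ P {v} e j f X → perturb (length P) e j f (P ++ v ∷ X) ≡ P ++ e ∷ mapPrefix f j X
perturb-++ []      e j f X = refl
perturb-++ (p ∷ P) e j f X = cong (p ∷_) (perturb-++ P e j f X)

perturbations : ℕ → List (ℕ × ℕ × ℕ × (ℕ → ℕ))
perturbations m = cartesianProduct (downFrom m)
  (cartesianProduct (downFrom (suc m)) (cartesianProduct (downFrom (suc m)) shifts))

nearby : ℕ → List ℕ → List (List ℕ)
nearby m c = map (λ (i , e , j , f) → perturb i e j f c) (perturbations m)

∈-nearby : ∀ {m i e j f} c → i < m → e ≤ m → j ≤ m → f ∈ shifts → perturb i e j f c ∈ nearby m c
∈-nearby c i<m e≤m j≤m f∈ = ∈-map⁺ _ (∈-cartesianProduct⁺ (∈-downFrom⁺ i<m)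
  (∈-cartesianProduct⁺ (∈-downFrom⁺ (s≤s e≤m)) (∈-cartesianProduct⁺ (∈-downFrom⁺ (s≤s j≤m)) f∈)))

nearbyCount : ℕ → ℕ
nearbyCount m = m * (suc m * (suc m * 2))

length-nearby : ∀ m c → length (nearby m c) ≡ nearbyCount m
length-nearby m c = begin
    length (nearby m c)
  ≡⟨ List.length-map _ (perturbations m) ⟩
    length (perturbations m)
  ≡⟨ length-cartesianProduct (downFrom m) (cartesianProduct range (cartesianProduct range shifts)) ⟩
    length (downFrom m) * length (cartesianProduct range (cartesianProduct range shifts))
  ≡⟨ cong (length (downFrom m) *_) (length-cartesianProduct range (cartesianProduct range shifts)) ⟩
    length (downFrom m) * (length range * length (cartesianProduct range shifts))
  ≡⟨ cong (λ n → length (downFrom m) * (length range * n)) (length-cartesianProduct range shifts) ⟩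
    length (downFrom m) * (length range * (length range * 2))
  ≡⟨ cong₂ (λ k n → k * (n * (n * 2))) (List.length-downFrom m) (List.length-downFrom (suc m)) ⟩
    nearbyCount m
  ∎
  where
  open ≡-Reasoning
  range = downFrom (suc m)

heights-swap : ∀ l a b r →
  heights [] (l ++ b ∷ a ∷ r) ∈ nearby (length (l ++ a ∷ b ∷ r)) (heights [] (l ++ a ∷ b ∷ r))
heights-swap l a b r with heights-swap-tail (stackAfter [] l) a b r
... | f , j , f∈ , j≤ , eq
  rewrite heights-++ [] l (a ∷ b ∷ r) | heights-++ [] l (b ∷ a ∷ r) | eq =
  subst (_∈ nearby m _) (perturb-++ P e j f X) (∈-nearby _ i<m e≤m j≤m f∈)
  where
  m = length (l ++ a ∷ b ∷ r)
  S = stackAfter [] l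
  P = heights [] l
  X = heights (push a S) (b ∷ r)
  e = length (push b S)
  l<m : length l < m
  l<m = subst (length l <_) (sym (List.length-++-sucʳ l a (b ∷ r))) (s≤s (List.length-++-≤ˡ l))
  i<m : length P < m
  i<m = subst (_< m) (sym (length-heights [] l)) l<m
  e≤m : e ≤ m
  e≤m = ℕ.≤-trans (s≤s (ℕ.≤-trans (length-pop b S) (length-stackAfter [] l))) l<m
  j≤m : j ≤ m
  j≤m = ℕ.≤-trans (ℕ.m≤n⇒m≤1+n j≤) (List.length-++-≤ʳ (a ∷ b ∷ r) {l})

edge-nearby : ∀ {m T U} → Edge m T U → code U ∈ nearby m (code T)
edge-nearby (_ , _ , _ , refl , (l , a , b , r , refl , refl) , refl , refl) =
  subst₂ (λ cU cT → cU ∈ nearby (length (l ++ a ∷ b ∷ r)) cT)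
    (heights-C (l ++ b ∷ a ∷ r)) (heights-C (l ++ a ∷ b ∷ r)) (heights-swap l a b r)

-- Balls in the swap graph

ball : ℕ → ℕ → List ℕ → List (List ℕ)
ball m zero    c = c ∷ []
ball m (suc k) c = concatMap (ball m k) (c ∷ nearby m c)

center-∈-ball : ∀ m k c → c ∈ ball m k c
center-∈-ball m zero    c = here refl
center-∈-ball m (suc k) c =
  ∈-concatMap⁺ (ball m k) {xs = c ∷ nearby m c} (here (center-∈-ball m k c))

walk-∈-ball : ∀ {m T U k K} → Walk m T U k → k ≤ K → code U ∈ ball m K (code T)
walk-∈-ball {m} {T} {K = K}     here       _         = center-∈-ball m K (code T)
walk-∈-ball {m} {T} {K = suc K} (step e w) (s≤s k≤K) =
  ∈-concatMap⁺ (ball m K) {xs = code T ∷ nearby m (code T)}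
    (there (lose (edge-nearby e) (walk-∈-ball w k≤K)))

length-ball : ∀ m k c → length (ball m k c) ≤ suc (nearbyCount m) ^ k
length-ball m zero    c = ℕ.≤-refl
length-ball m (suc k) c = ℕ.≤-trans
  (length-concatMap-≤ (ball m k) (length-ball m k) (c ∷ nearby m c))
  (ℕ.*-monoˡ-≤ _ (s≤s (ℕ.≤-reflexive (length-nearby m c))))

far-apart : ∀ {m T T′} K → code T′ ∉ ball m K (code T) → ∀ k → Walk m T T′ k → K < k
far-apart K T′∉ k w = ℕ.≰⇒> (λ k≤K → T′∉ (walk-∈-ball w k≤K))

-- Path-shaped trees

pathTrees : ℕ → List Tree
pathTrees zero    = node leaf leaf ∷ []
pathTrees (suc n) = map (node leaf) (pathTrees n) ++ map (λ t → node t leaf) (pathTrees n)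

length-pathTrees : ∀ n → length (pathTrees n) ≡ 2 ^ n
length-pathTrees zero    = refl
length-pathTrees (suc n) = begin
    length (map (node leaf) ts ++ map (λ t → node t leaf) ts)
  ≡⟨ List.length-++ (map (node leaf) ts) ⟩
    length (map (node leaf) ts) + length (map (λ t → node t leaf) ts)
  ≡⟨ cong₂ _+_ (List.length-map (node leaf) ts) (List.length-map (λ t → node t leaf) ts) ⟩
    length ts + length ts
  ≡⟨ cong (λ k → k + k) (length-pathTrees n) ⟩
    2 ^ n + 2 ^ n
  ≡⟨ cong (2 ^ n +_) (sym (ℕ.+-identityʳ (2 ^ n))) ⟩
    2 ^ suc n
  ∎
  where
  open ≡-Reasoning
  ts = pathTrees n

size-pathTrees : ∀ n → All (λ t → size t ≡ suc n) (pathTrees n)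
size-pathTrees zero    = refl ∷ []
size-pathTrees (suc n) = All.++⁺
  (All.map⁺ (All.map (cong suc) (size-pathTrees n)))
  (All.map⁺ (All.map (cong suc ∘ trans (ℕ.+-identityʳ _)) (size-pathTrees n)))

leaf∉pathTrees : ∀ n → leaf ∉ pathTrees n
leaf∉pathTrees n leaf∈ = ℕ.0≢1+n (All.lookup (size-pathTrees n) leaf∈)

pathTrees-unique : ∀ n → Unique (pathTrees n)
pathTrees-unique zero    = [] ∷ []
pathTrees-unique (suc n) = Unique.++⁺
  (Unique.map⁺ (λ { refl → refl }) (pathTrees-unique n))
  (Unique.map⁺ (λ { refl → refl }) (pathTrees-unique n))
  disjoint
  where
  disjoint : Disjoint (map (node leaf) (pathTrees n)) (map (λ t → node t leaf) (pathTrees n))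
  disjoint (p , q) with ∈-map⁻ (node leaf) p | ∈-map⁻ (λ t → node t leaf) q
  ... | _ , _ , refl | _ , leaf∈ , refl = leaf∉pathTrees n leaf∈

code-∉ : ∀ n (cs : List (List ℕ)) → length cs < 2 ^ n → ∃ λ T → size T ≡ suc n × code T ∉ cs
code-∉ n cs |cs|< with pigeonhole (List.≡-dec ℕ._≟_) cs
  (Unique.map⁺ (rightDepths-injective 0) (pathTrees-unique n))
  (subst (length cs <_)
    (sym (trans (List.length-map code (pathTrees n)) (length-pathTrees n))) |cs|<)
... | c , c∈ , c∉cs with ∈-map⁻ code c∈
...   | T , T∈ , refl = T , All.lookup (size-pathTrees n) T∈ , c∉cs

rightComb : ℕ → Tree
rightComb zero    = leaf
rightComb (suc n) = node leaf (rightComb n)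

size-rightComb : ∀ n → size (rightComb n) ≡ n
size-rightComb zero    = refl
size-rightComb (suc n) = cong suc (size-rightComb n)

⌊log₂n⌋≥1 : ∀ n → 2 ≤ n → 1 ≤ ⌊log₂ n ⌋
⌊log₂n⌋≥1 n 2≤n = subst (_≤ ⌊log₂ n ⌋) (⌊log₂[2^n]⌋≡n 1) (⌊log₂⌋-mono-≤ 2≤n)

n<2^[1+⌊log₂n⌋] : ∀ n → n < 2 ^ suc ⌊log₂ n ⌋
n<2^[1+⌊log₂n⌋] n = ℕ.≰⇒> λ 2^≤n → ℕ.<-irrefl refl
  (subst (_≤ ⌊log₂ n ⌋) (⌊log₂[2^n]⌋≡n (suc ⌊log₂ n ⌋)) (⌊log₂⌋-mono-≤ 2^≤n))

m<[1+m/n]*n : ∀ m n .{{_ : NonZero n}} → m < suc (m / n) * n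
m<[1+m/n]*n m n = begin-strict
  m                 ≡⟨ m≡m%n+[m/n]*n m n ⟩
  m % n + m / n * n <⟨ ℕ.+-monoˡ-< (m / n * n) (m%n<n m n) ⟩
  n + m / n * n     ∎
  where open ℕ.≤-Reasoning

1+nearbyCount≤ : ∀ {m L} → 2 ≤ m → 1 ≤ L → m < 2 ^ suc L → suc (nearbyCount m) ≤ 2 ^ (8 * L)
1+nearbyCount≤ {m} {L} 2≤m 1≤L m<P = begin
  suc (m * X)      ≤⟨ ℕ.+-monoˡ-≤ (m * X) (s≤s z≤n) ⟩
  suc m * X        ≤⟨ ℕ.*-mono-≤ m<P (ℕ.*-mono-≤ m<P (ℕ.*-mono-≤ m<P 2≤P)) ⟩
  P * (P * (P * P)) ≡⟨ cong (λ z → P * (P * (P * z))) (sym (ℕ.*-identityʳ P)) ⟩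
  P ^ 4            ≡⟨ ℕ.^-*-assoc 2 (suc L) 4 ⟩
  2 ^ (suc L * 4)  ≤⟨ ℕ.^-monoʳ-≤ 2 4+4L≤8L ⟩
  2 ^ (8 * L)      ∎
  where
  open ℕ.≤-Reasoning
  X = suc m * (suc m * 2)
  P = 2 ^ suc L
  2≤P : 2 ≤ P
  2≤P = ℕ.≤-trans 2≤m (ℕ.<⇒≤ m<P)
  4+4L≤8L : suc L * 4 ≤ 8 * L
  4+4L≤8L = ℕ.≤-trans (ℕ.+-mono-≤ (ℕ.*-monoʳ-≤ 4 1≤L) (ℕ.≤-reflexive (ℕ.*-comm L 4)))
                      (ℕ.≤-reflexive (sym (ℕ.*-distribʳ-+ L 4 4)))

2+t≤9Lk : ∀ {t L K k} → 1 ≤ L → t < suc K * (8 * L) → K < k → 2 + t ≤ 9 * L * k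
2+t≤9Lk {t} {L} {K} {k} 1≤L t< K<k = begin
  2 + t                 ≤⟨ s≤s t< ⟩
  suc (suc K * (8 * L)) ≤⟨ s≤s (ℕ.*-monoˡ-≤ (8 * L) K<k) ⟩
  suc (k * (8 * L))     ≡⟨ cong suc (ℕ.*-comm k (8 * L)) ⟩
  suc (8 * L * k)       ≤⟨ ℕ.+-monoˡ-≤ (8 * L * k) (ℕ.*-mono-≤ 1≤L (ℕ.≤-trans (s≤s z≤n) K<k)) ⟩
  L * k + 8 * L * k     ≡⟨ ℕ.*-distribʳ-+ k L (8 * L) ⟨
  9 * L * k             ∎
  where open ℕ.≤-Reasoning

distant-trees : ∀ t L → 1 ≤ L → 2 + t < 2 ^ suc L →
  Σ Tree λ T → Σ Tree λ T′ → size T ≡ 2 + t × size T′ ≡ 2 + t ×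
    (∀ k → Walk (2 + t) T T′ k → 2 + t ≤ 9 * L * k)
distant-trees t L 1≤L m<2^ =
  let T′ , |T′| , T′∉ball = code-∉ (suc t) (ball m K (code T)) |ball|<2^
  in T , T′ , size-rightComb m , |T′| ,
     λ k w → 2+t≤9Lk 1≤L (m<[1+m/n]*n t D) (far-apart K T′∉ball k w)
  where
  m = 2 + t
  D = 8 * L
  instance
    D-nonZero : NonZero D
    D-nonZero = ℕ.>-nonZero (ℕ.≤-trans 1≤L (ℕ.m≤n*m L 8))
  -- the largest K with 8LK ≤ m - 2, so that balls of radius K are smaller than 2^(m-1)
  K = t / D
  -- any tree with m nodes would do as the centre
  T = rightComb m
  |ball|<2^ : length (ball m K (code T)) < 2 ^ suc t
  |ball|<2^ = begin-strict
    length (ball m K (code T))  ≤⟨ length-ball m K (code T) ⟩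
    suc (nearbyCount m) ^ K     ≤⟨ ℕ.^-monoˡ-≤ K (1+nearbyCount≤ (s≤s (s≤s z≤n)) 1≤L m<2^) ⟩
    (2 ^ D) ^ K                 ≡⟨ ℕ.^-*-assoc 2 D K ⟩
    2 ^ (D * K)                 ≡⟨ cong (2 ^_) (ℕ.*-comm D K) ⟩
    2 ^ (K * D)                 ≤⟨ ℕ.^-monoʳ-≤ 2 (m/n*n≤m t D) ⟩
    2 ^ t                       <⟨ ℕ.^-monoʳ-< 2 (s≤s (s≤s z≤n)) (ℕ.n<1+n t) ⟩
    2 ^ suc t                   ∎
    where open ℕ.≤-Reasoning

lemma15 : Σ ℕ λ c → Σ ℕ λ N → ∀ m → N ≤ m →
    Σ Tree λ T → Σ Tree λ T' → size T ≡ m × size T' ≡ m ×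
      (∀ k → Walk m T T' k → m ≤ c * ⌊log₂ m ⌋ * k)
lemma15 = 9 , 2 , λ where
  (suc (suc t)) 2≤m →
    distant-trees t ⌊log₂ (2 + t) ⌋ (⌊log₂n⌋≥1 (2 + t) 2≤m) (n<2^[1+⌊log₂n⌋] (2 + t))
  (suc zero) (s≤s ())
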